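{- Let $\lambda=(\lambda_1,\dots,\lambda_n)$ be a vector of positive integers, fix $1\le i\le n$, let $\ell=\operatorname{lcm}(\lambda_1,\dots,\lambda_{i-1},\lambda_{i+1},\dots,\lambda_n)$, and define $\lambda'$ by $\lambda'_j=\lambda_j$ for $j\ne i$ and $\lambda'_i=\lambda_i+\ell$. Assume that $Q(\lambda)$ has no holes in its boundary. Then there is a bijective linear map $\alpha:\mathbb{Z}^{n+1}\to\mathbb{Z}^{n+1}$ such that the preimage under $\alpha$ of every hole of $Q(\lambda')$ is a hole of $Q(\lambda)$. Moreover, $\sigma_i(\alpha(z))>\sigma_i(z)$ for every hole $z$ of $Q(\lambda)$, while $\sigma_j(\alpha(z))=\sigma_j(z)$ for all $j\ne i$ and $\sigma_{\lambda'}(\alpha(z))=\sigma_\lambda(z)$ for all $z\in\mathbb{Z}^{n+1}$. In particular, $Q(\lambda')$ also has no holes in its boundary.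
   Context: Let $e_i$ be the $i$-th unit vector of $\mathbb{R}^{n+1}$. For a vector $\lambda=(\lambda_1,\dots,\lambda_n)$ of positive integers, $Q(\lambda)\subset\mathbb{Z}^{n+1}$ is the affine semigroup generated by all points $(p,1)$ with $p\in\mathbb{Z}^n$ lying in the simplex with vertices $0,\lambda_1e_1,\dots,\lambda_ne_n$ of $\mathbb{R}^n$. Its normalization is $\overline{Q}(\lambda)=\mathbb{Z}^{n+1}\cap\mathbb{R}_{\ge0}Q(\lambda)$, and a hole is an element of $\overline{Q}(\lambda)\setminus Q(\lambda)$. The facets of $Q(\lambda)$ are the coordinate facets $F_j$ with lattice height $\sigma_j(z)=z_j$ ($1\le j\le n$) and the skew facet spanned by $\lambda_je_j+e_{n+1}$, $1\le j\le n$, with lattice height $\sigma_\lambda(z)=Lz_{n+1}-\sum_{j=1}^n\frac{L}{\lambda_j}z_j$, $L=\operatorname{lcm}(\lambda_1,\dots,\lambda_n)$. A hole lies in the boundary if some lattice height of it is $0$. -}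

module Defs where

open import Data.Nat as ℕ using (ℕ; zero; suc)
open import Data.Nat.LCM using (lcm)
open import Data.Integer as ℤ using (ℤ; +_; _+_; _*_; _-_; _≤_; _<_)
open import Data.Fin using (Fin; zero; suc; _≟_)
open import Data.List using (List; []; _∷_)
open import Data.List.Relation.Unary.All using (All)
open import Data.Product using (Σ; _×_; _,_; ∃)
open import Data.Sum using (_⊎_)
open import Data.Bool using (if_then_else_)
open import Relation.Nullary using (¬_; does)
open import Relation.Binary.PropositionalEquality using (_≡_)

Positive : {n : ℕ} → (Fin n → ℕ) → Set
Positive lam = ∀ j → 0 ℕ.< lam j

-- Points of ℤ^{n+1}, written as (z₁,…,zₙ ; z_{n+1}).
Point : ℕ → Set
Point n = (Fin n → ℤ) × ℤ

_≈ᵖ_ : {n : ℕ} → Point n → Point n → Set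
(x , t) ≈ᵖ (y , s) = (∀ j → x j ≡ y j) × (t ≡ s)

0ᵖ : {n : ℕ} → Point n
0ᵖ = (λ _ → + 0) , + 0

_+ᵖ_ : {n : ℕ} → Point n → Point n → Point n
(x , t) +ᵖ (y , s) = (λ j → x j + y j) , (t + s)

_·ᵖ_ : {n : ℕ} → ℤ → Point n → Point n
k ·ᵖ (x , t) = (λ j → k * x j) , (k * t)

Σℤ : (n : ℕ) → (Fin n → ℤ) → ℤ
Σℤ zero    f = + 0
Σℤ (suc n) f = f zero + Σℤ n (λ j → f (suc j))

lcmF : (n : ℕ) → (Fin n → ℕ) → ℕ
lcmF zero    f = 1
lcmF (suc n) f = lcm (f zero) (lcmF n (λ j → f (suc j)))

-- natural division, total (divisor 0 gives 0; only used with positive divisors)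
_div_ : ℕ → ℕ → ℕ
m div zero  = 0
m div suc k = m ℕ./ suc k

Lcm : {n : ℕ} → (Fin n → ℕ) → ℕ
Lcm {n} lam = lcmF n lam

lcmExcept : {n : ℕ} → (Fin n → ℕ) → Fin n → ℕ
lcmExcept {n} lam i = lcmF n (λ j → if does (j ≟ i) then 1 else lam j)

lamPrime : {n : ℕ} → (Fin n → ℕ) → Fin n → (Fin n → ℕ)
lamPrime lam i j = if does (j ≟ i) then lam i ℕ.+ lcmExcept lam i else lam j

σ : {n : ℕ} → Fin n → Point n → ℤ
σ j (x , t) = x j

σλ : {n : ℕ} → (Fin n → ℕ) → Point n → ℤ
σλ {n} lam (x , t) =
  (+ Lcm lam) * t - Σℤ n (λ j → (+ (Lcm lam div lam j)) * x j)

-- p ∈ ℤⁿ lies in the simplex conv(0, λ₁e₁, …, λₙeₙ):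
-- p_j ≥ 0 and Σ p_j/λ_j ≤ 1 (multiplied through by L).
InSimplex : {n : ℕ} → (Fin n → ℕ) → (Fin n → ℤ) → Set
InSimplex {n} lam p =
  (∀ j → + 0 ≤ p j) × (Σℤ n (λ j → (+ (Lcm lam div lam j)) * p j) ≤ + Lcm lam)

gen : {n : ℕ} → (Fin n → ℤ) → Point n
gen p = p , + 1

sumᵖ : {n : ℕ} → List (Point n) → Point n
sumᵖ []       = 0ᵖ
sumᵖ (z ∷ zs) = z +ᵖ sumᵖ zs

-- Q(λ): the affine semigroup (monoid, containing 0) generated by the (p,1)
InQ : {n : ℕ} → (Fin n → ℕ) → Point n → Set
InQ lam z = Σ (List _) λ ps → All (InSimplex lam) ps × (sumᵖ (Data.List.map gen ps) ≈ᵖ z)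
  where import Data.List

-- normalization \bar Q(λ) = ℤ^{n+1} ∩ ℝ_{≥0} Q(λ): lattice points some positive
-- multiple of which lies in Q(λ)
InQbar : {n : ℕ} → (Fin n → ℕ) → Point n → Set
InQbar lam z = ∃ λ k → InQ lam ((+ suc k) ·ᵖ z)

IsHole : {n : ℕ} → (Fin n → ℕ) → Point n → Set
IsHole lam z = InQbar lam z × ¬ InQ lam z

InBoundary : {n : ℕ} → (Fin n → ℕ) → Point n → Set
InBoundary lam z = (∃ λ j → σ j z ≡ + 0) ⊎ (σλ lam z ≡ + 0)

NoBoundaryHoles : {n : ℕ} → (Fin n → ℕ) → Set
NoBoundaryHoles lam = ∀ z → IsHole lam z → ¬ InBoundary lam z

IsLinear : {n : ℕ} → (Point n → Point n) → Set
IsLinear α = (∀ z w → α (z +ᵖ w) ≈ᵖ (α z +ᵖ α w)) × (∀ k z → α (k ·ᵖ z) ≈ᵖ (k ·ᵖ α z))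

IsBijective : {n : ℕ} → (Point n → Point n) → Set
IsBijective α = (∀ z w → α z ≈ᵖ α w → z ≈ᵖ w) × (∀ y → ∃ λ z → α z ≈ᵖ y)

{-# OPTIONS --safe #-}
-- Let ℓ = lcm(λⱼ : j ≠ i), d = L/λᵢ and c(z) = ℓ z_{n+1} − Σ_{j≠i} (ℓ/λⱼ) zⱼ. The map
-- α(z) = z + c(z) eᵢ only moves the i-th coordinate and is invertible because c ignores zᵢ.
-- As gcd(ℓ, λᵢ + ℓ) = gcd(ℓ, λᵢ), one has L′ = d (λᵢ + ℓ) = L + dℓ and L′/λ′ⱼ = L/λⱼ + d ℓ/λⱼ
-- for j ≠ i, so σ_{λ′} = σ_λ + d c and hence σ_{λ′} ∘ α = σ_λ; moreover L c = ℓ (σ_λ + d σᵢ).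
-- Thus c ≥ 0 on the cone of λ, so α maps generators of Q(λ) to generators of Q(λ′), and
-- c > 0 on holes, which avoid the skew facet. If α(z) is a hole of λ′, the only way z can
-- leave the cone of λ is zᵢ < 0; but then the projection of z to the facet zᵢ = 0 is a
-- boundary point of the cone, hence lies in Q(λ), and lowering its image along eᵢ puts α(z)
-- in Q(λ′). Boundary holes of λ′ therefore pull back to boundary holes of λ, except on Fᵢ,
-- where σᵢ strictly increases.

module Submission where

open import Defs
open import Data.Nat using (ℕ)
open import Data.Fin using (Fin)
open import Data.Integer using (_<_)
open import Data.Product using (Σ; _×_)
open import Relation.Nullary using (¬_)
open import Relation.Binary.PropositionalEquality using (_≡_)

import Data.Nat as ℕ
import Data.Nat.Properties as ℕP
import Data.Nat.Tactic.RingSolver as ℕSolver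
open import Data.Nat.Divisibility as ℕD using (_∣_; divides)
open import Data.Nat.DivMod using (m*n/n≡m; m/n*n≡m)
open import Data.Nat.GCD using (gcd)
open import Data.Nat.LCM using (lcm; m∣lcm[m,n]; n∣lcm[m,n]; lcm-least; gcd*lcm)
open import Data.Integer using (ℤ; +_; -[1+_]; _+_; _*_; _-_; -_; _≤_; +≤+; +<+)
import Data.Integer.Properties as ℤP
open import Data.Integer.Tactic.RingSolver using (solve-∀)
open import Data.Fin using (zero; suc; _≟_)
import Data.Fin.Properties as FinP
open import Data.List using ([]; _∷_; map; _++_)
open import Data.List.Relation.Unary.All using (All; []; _∷_)
open import Data.List.Relation.Unary.All.Properties using (++⁺)
open import Data.Product using (_,_; proj₁; proj₂)
open import Data.Sum using (inj₁; inj₂)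
open import Data.Bool using (if_then_else_)
open import Data.Empty using (⊥)
open import Function using (_∘_)
open import Relation.Nullary using (does; yes; no; contradiction)
open import Relation.Binary.PropositionalEquality
  using (refl; sym; trans; cong; cong₂; subst; subst₂; module ≡-Reasoning)

if-diag : ∀ {a} {A : Set a} {n} (i : Fin n) {x y : A} → (if does (i ≟ i) then x else y) ≡ x
if-diag i with i ≟ i
... | yes _   = refl
... | no i≢i = contradiction refl i≢i

if-offDiag : ∀ {a} {A : Set a} {n} {i j : Fin n} {x y : A} → ¬ j ≡ i → (if does (j ≟ i) then x else y) ≡ y
if-offDiag {i = i} {j} j≢i with j ≟ i
... | yes j≡i = contradiction j≡i j≢i
... | no _    = refl

cases-≟ : ∀ {n p} {P : Fin n → Set p} (i : Fin n) → P i → (∀ {j} → ¬ j ≡ i → P j) → ∀ j → P j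
cases-≟ i Pᵢ P≢ᵢ j with j ≟ i
... | yes refl = Pᵢ
... | no j≢i   = P≢ᵢ j≢i

δ : {n : ℕ} → Fin n → Fin n → ℤ
δ i j = if does (j ≟ i) then + 1 else + 0

δ-sym : {n : ℕ} (i j : Fin n) → δ i j ≡ δ j i
δ-sym i j with j ≟ i | i ≟ j
... | yes _   | yes _   = refl
... | no _    | no _    = refl
... | yes j≡i | no i≢j = contradiction (sym j≡i) i≢j
... | no j≢i  | yes i≡j = contradiction (sym i≡j) j≢i

δ-nonNeg : {n : ℕ} (i j : Fin n) → + 0 ≤ δ i j
δ-nonNeg i j with j ≟ i
... | yes _ = +≤+ ℕ.z≤n
... | no _  = +≤+ ℕ.z≤n

+-nonNeg : ∀ {i j} → + 0 ≤ i → + 0 ≤ j → + 0 ≤ i + j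
+-nonNeg = ℤP.+-mono-≤

*-nonNeg : ∀ {i j} → + 0 ≤ i → + 0 ≤ j → + 0 ≤ i * j
*-nonNeg {+ m} {+ k} _ _ = subst (+ 0 ≤_) (ℤP.pos-* m k) (+≤+ ℕ.z≤n)

pos*-nonNeg : ∀ m {i} → + 0 ≤ i → + 0 ≤ + m * i
pos*-nonNeg m = *-nonNeg {+ m} (+≤+ ℕ.z≤n)

+-pos-nonNeg : ∀ {i j} → + 0 < i → + 0 ≤ j → + 0 < i + j
+-pos-nonNeg {i} {j} i>0 j≥0 = ℤP.<-≤-trans i>0 (subst (_≤ i + j) (ℤP.+-identityʳ i) (ℤP.+-monoʳ-≤ i j≥0))

*-pos : ∀ {i j} → + 0 < i → + 0 < j → + 0 < i * j
*-pos {+ ℕ.suc m} {+ ℕ.suc k} _        _        = +<+ (ℕ.s≤s ℕ.z≤n)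
*-pos {+ ℕ.zero}             (+<+ ()) _
*-pos {+ ℕ.suc m} {+ ℕ.zero}  _        (+<+ ())

*-cancelˡ-nonNeg : ∀ {m x} → 0 ℕ.< m → + 0 ≤ + m * x → + 0 ≤ x
*-cancelˡ-nonNeg {ℕ.suc _} {+ _}      _ _  = +≤+ ℕ.z≤n
*-cancelˡ-nonNeg {ℕ.suc _} { -[1+ _ ]} _ ()

*-cancelˡ-pos : ∀ {m x} → + 0 < + m * x → + 0 < x
*-cancelˡ-pos {m} {x} m*x>0 = ℤP.*-cancelˡ-<-nonNeg (+ m) (subst (_< + m * x) (sym (ℤP.*-zeroʳ (+ m))) m*x>0)

Σ-cong : ∀ n {f g : Fin n → ℤ} → (∀ j → f j ≡ g j) → Σℤ n f ≡ Σℤ n g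
Σ-cong ℕ.zero    f≗g = refl
Σ-cong (ℕ.suc n) f≗g = cong₂ _+_ (f≗g zero) (Σ-cong n (λ j → f≗g (suc j)))

Σ-+ : ∀ n (f g : Fin n → ℤ) → Σℤ n (λ j → f j + g j) ≡ Σℤ n f + Σℤ n g
Σ-+ ℕ.zero    f g = refl
Σ-+ (ℕ.suc n) f g = trans (cong (_+_ (f zero + g zero)) (Σ-+ n _ _)) (interchange (f zero) (g zero) _ _)
  where interchange : ∀ a b c d → a + b + (c + d) ≡ a + c + (b + d)
        interchange = solve-∀

Σ-*ˡ : ∀ n k (f : Fin n → ℤ) → Σℤ n (λ j → k * f j) ≡ k * Σℤ n f
Σ-*ˡ ℕ.zero    k f = sym (ℤP.*-zeroʳ k)
Σ-*ˡ (ℕ.suc n) k f = trans (cong (_+_ (k * f zero)) (Σ-*ˡ n k _)) (sym (ℤP.*-distribˡ-+ k _ _))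

Σ-zero : ∀ n → Σℤ n (λ _ → + 0) ≡ + 0
Σ-zero ℕ.zero    = refl
Σ-zero (ℕ.suc n) = trans (ℤP.+-identityˡ _) (Σ-zero n)

Σ-single : ∀ n (i : Fin n) (f : Fin n → ℤ) → (∀ j → ¬ j ≡ i → f j ≡ + 0) → Σℤ n f ≡ f i
Σ-single (ℕ.suc n) zero f f≡0 = begin
  f zero + Σℤ n (λ j → f (suc j))   ≡⟨ cong (_+_ (f zero)) (Σ-cong n (λ j → f≡0 (suc j) λ ())) ⟩
  f zero + Σℤ n (λ _ → + 0)         ≡⟨ cong (_+_ (f zero)) (Σ-zero n) ⟩
  f zero + + 0                      ≡⟨ ℤP.+-identityʳ _ ⟩
  f zero                            ∎
  where open ≡-Reasoning
Σ-single (ℕ.suc n) (suc i) f f≡0 =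
  trans (cong (_+ Σℤ n (λ j → f (suc j))) (f≡0 zero λ ()))
        (trans (ℤP.+-identityˡ _) (Σ-single n i _ (λ j j≢i → f≡0 (suc j) (j≢i ∘ FinP.suc-injective))))

Σ-agreeExcept : ∀ n (i : Fin n) (f g : Fin n → ℤ) → (∀ j → ¬ j ≡ i → f j ≡ g j) →
                Σℤ n f ≡ Σℤ n g + (f i - g i)
Σ-agreeExcept n i f g f≡g = begin
  Σℤ n f                                  ≡⟨ Σ-cong n (λ j → split (f j) (g j)) ⟩
  Σℤ n (λ j → g j + (f j - g j))          ≡⟨ Σ-+ n g _ ⟩
  Σℤ n g + Σℤ n (λ j → f j - g j)         ≡⟨ cong (_+_ (Σℤ n g)) (Σ-single n i _ differ) ⟩
  Σℤ n g + (f i - g i)                    ∎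
  where
  open ≡-Reasoning
  split : ∀ a b → a ≡ b + (a - b)
  split = solve-∀
  differ : ∀ j → ¬ j ≡ i → f j - g j ≡ + 0
  differ j j≢i = trans (cong (_- g j) (f≡g j j≢i)) (ℤP.+-inverseʳ (g j))

-- Least common multiples

lcm-pos : ∀ {m k} → 0 ℕ.< m → 0 ℕ.< k → 0 ℕ.< lcm m k
lcm-pos {m} {k} m>0 k>0 = ℕP.n≢0⇒n>0 λ lcm≡0 → ℕP.<⇒≢ (ℕP.*-mono-< m>0 k>0) (sym (begin
  m ℕ.* k              ≡⟨ sym (gcd*lcm m k) ⟩
  gcd m k ℕ.* lcm m k  ≡⟨ cong (gcd m k ℕ.*_) lcm≡0 ⟩
  gcd m k ℕ.* 0        ≡⟨ ℕP.*-zeroʳ (gcd m k) ⟩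
  0                    ∎))
  where open ≡-Reasoning

-- lcm ℓ m / m = ℓ / gcd ℓ m, and gcd ℓ (m + ℓ) = gcd ℓ m.
lcm-shift : ∀ ℓ m d → 0 ℕ.< m → lcm ℓ m ≡ d ℕ.* m → lcm ℓ (m ℕ.+ ℓ) ≡ d ℕ.* (m ℕ.+ ℓ)
lcm-shift ℓ m d m>0 L≡dm = ℕD.∣-antisym upper lower
  where
  ℓ∣dm : ℓ ∣ d ℕ.* m
  ℓ∣dm = subst (ℓ ∣_) L≡dm (m∣lcm[m,n] ℓ m)
  upper : lcm ℓ (m ℕ.+ ℓ) ∣ d ℕ.* (m ℕ.+ ℓ)
  upper = lcm-least (subst (ℓ ∣_) (sym (ℕP.*-distribˡ-+ d m ℓ)) (ℕD.∣m∣n⇒∣m+n ℓ∣dm (ℕD.n∣m*n d)))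
                    (ℕD.n∣m*n d)
  lower : d ℕ.* (m ℕ.+ ℓ) ∣ lcm ℓ (m ℕ.+ ℓ)
  lower with n∣lcm[m,n] ℓ (m ℕ.+ ℓ)
  ... | divides e L′≡e[m+ℓ] = subst (d ℕ.* (m ℕ.+ ℓ) ∣_) (sym L′≡e[m+ℓ]) (ℕD.*-monoˡ-∣ (m ℕ.+ ℓ) d∣e)
    where
    L′≡eℓ+em : lcm ℓ (m ℕ.+ ℓ) ≡ e ℕ.* ℓ ℕ.+ e ℕ.* m
    L′≡eℓ+em = trans L′≡e[m+ℓ] (trans (ℕP.*-distribˡ-+ e m ℓ) (ℕP.+-comm (e ℕ.* m) (e ℕ.* ℓ)))
    ℓ∣em : ℓ ∣ e ℕ.* m
    ℓ∣em = ℕD.∣m+n∣m⇒∣n (subst (ℓ ∣_) L′≡eℓ+em (m∣lcm[m,n] ℓ (m ℕ.+ ℓ))) (ℕD.n∣m*n e)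
    d∣e : d ∣ e
    d∣e = ℕD.*-cancelʳ-∣ m {{ℕ.>-nonZero m>0}} (subst (_∣ e ℕ.* m) L≡dm (lcm-least ℓ∣em (ℕD.n∣m*n e)))

div-exact : ∀ {m k} → 0 ℕ.< k → k ∣ m → (m div k) ℕ.* k ≡ m
div-exact {k = ℕ.suc _} _ k∣m = m/n*n≡m k∣m

div-unique : ∀ {m k q} → 0 ℕ.< k → m ≡ q ℕ.* k → m div k ≡ q
div-unique {k = ℕ.suc k} {q} _ refl = m*n/n≡m q (ℕ.suc k)

lcmF-∣ : ∀ n (f : Fin n → ℕ) j → f j ∣ lcmF n f
lcmF-∣ (ℕ.suc n) f zero    = m∣lcm[m,n] _ _
lcmF-∣ (ℕ.suc n) f (suc j) = ℕD.∣-trans (lcmF-∣ n _ j) (n∣lcm[m,n] (f zero) _)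

lcmF-least : ∀ n (f : Fin n → ℕ) {m} → (∀ j → f j ∣ m) → lcmF n f ∣ m
lcmF-least ℕ.zero    f {m} _   = ℕD.1∣ m
lcmF-least (ℕ.suc n) f     f∣m = lcm-least (f∣m zero) (lcmF-least n _ (λ j → f∣m (suc j)))

lcmF-pos : ∀ n (f : Fin n → ℕ) → (∀ j → 0 ℕ.< f j) → 0 ℕ.< lcmF n f
lcmF-pos ℕ.zero    f _   = ℕ.s≤s ℕ.z≤n
lcmF-pos (ℕ.suc n) f f>0 = lcm-pos (f>0 zero) (lcmF-pos n _ (λ j → f>0 (suc j)))

lcmF-cong : ∀ n {f g : Fin n → ℕ} → (∀ j → f j ≡ g j) → lcmF n f ≡ lcmF n g
lcmF-cong ℕ.zero    _   = refl
lcmF-cong (ℕ.suc n) f≗g = cong₂ lcm (f≗g zero) (lcmF-cong n (λ j → f≗g (suc j)))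

lcmExcept-∣ : ∀ {n} (f : Fin n → ℕ) {i j} → ¬ j ≡ i → f j ∣ lcmExcept f i
lcmExcept-∣ {n} f {i} {j} j≢i = subst (_∣ lcmExcept f i) (if-offDiag j≢i) (lcmF-∣ n _ j)

lcmExcept-least : ∀ {n} (f : Fin n → ℕ) i {m} → (∀ j → ¬ j ≡ i → f j ∣ m) → lcmExcept f i ∣ m
lcmExcept-least {n} f i {m} f∣m = lcmF-least n _ except∣m
  where
  except∣m : ∀ j → (if does (j ≟ i) then 1 else f j) ∣ m
  except∣m j with j ≟ i
  ... | yes _   = ℕD.1∣ m
  ... | no j≢i = f∣m j j≢i

lcmF-split : ∀ n (f : Fin n → ℕ) i → lcmF n f ≡ lcm (lcmExcept f i) (f i)
lcmF-split n f i = ℕD.∣-antisym (lcmF-least n f ∣lcm) (lcm-least (lcmExcept-least f i (λ j _ → lcmF-∣ n f j)) (lcmF-∣ n f i))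
  where
  ∣lcm : ∀ j → f j ∣ lcm (lcmExcept f i) (f i)
  ∣lcm j with j ≟ i
  ... | yes refl = n∣lcm[m,n] (lcmExcept f i) (f i)
  ... | no j≢i   = ℕD.∣-trans (lcmExcept-∣ f j≢i) (m∣lcm[m,n] (lcmExcept f i) (f i))

-- Linear forms and shifts along a coordinate axis

≈ᵖ-refl : ∀ {n} {z : Point n} → z ≈ᵖ z
≈ᵖ-refl = (λ _ → refl) , refl

≈ᵖ-reflexive : ∀ {n} {z w : Point n} → z ≡ w → z ≈ᵖ w
≈ᵖ-reflexive refl = (λ _ → refl) , refl

≈ᵖ-sym : ∀ {n} {z w : Point n} → z ≈ᵖ w → w ≈ᵖ z
≈ᵖ-sym (x≗y , t≡s) = (λ j → sym (x≗y j)) , sym t≡s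

≈ᵖ-trans : ∀ {n} {z w u : Point n} → z ≈ᵖ w → w ≈ᵖ u → z ≈ᵖ u
≈ᵖ-trans (x≗y , t≡s) (y≗u , s≡r) = (λ j → trans (x≗y j) (y≗u j)) , trans t≡s s≡r

+ᵖ-cong : ∀ {n} {z z′ w w′ : Point n} → z ≈ᵖ z′ → w ≈ᵖ w′ → (z +ᵖ w) ≈ᵖ (z′ +ᵖ w′)
+ᵖ-cong (x≗x′ , t≡t′) (y≗y′ , s≡s′) = (λ j → cong₂ _+_ (x≗x′ j) (y≗y′ j)) , cong₂ _+_ t≡t′ s≡s′

·ᵖ-cong : ∀ {n} k {z z′ : Point n} → z ≈ᵖ z′ → (k ·ᵖ z) ≈ᵖ (k ·ᵖ z′)
·ᵖ-cong k (x≗x′ , t≡t′) = (λ j → cong (k *_) (x≗x′ j)) , cong (k *_) t≡t′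

Σᵖ : ∀ {n} m → (Fin m → Point n) → Point n
Σᵖ ℕ.zero    f = 0ᵖ
Σᵖ (ℕ.suc m) f = f zero +ᵖ Σᵖ m (λ j → f (suc j))

σ-Σᵖ : ∀ {n} m (f : Fin m → Point n) k → σ k (Σᵖ m f) ≡ Σℤ m (λ j → σ k (f j))
σ-Σᵖ ℕ.zero    f k = refl
σ-Σᵖ (ℕ.suc m) f k = cong (_+_ (σ k (f zero))) (σ-Σᵖ m _ k)

last-Σᵖ : ∀ {n} m (f : Fin m → Point n) → proj₂ (Σᵖ m f) ≡ Σℤ m (λ j → proj₂ (f j))
last-Σᵖ ℕ.zero    f = refl
last-Σᵖ (ℕ.suc m) f = cong (_+_ (proj₂ (f zero))) (last-Σᵖ m _)

-- σλ μ is definitionally height (Lcm μ) (skewCoeff μ).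
height : {n : ℕ} → ℕ → (Fin n → ℕ) → Point n → ℤ
height {n} s w (x , t) = + s * t - Σℤ n (λ j → + w j * x j)

Σ-δ : ∀ n (i : Fin n) (f : Fin n → ℤ) → Σℤ n (λ j → f j * δ i j) ≡ f i
Σ-δ n i f = trans (Σ-single n i _ (λ j j≢i → trans (cong (f j *_) (if-offDiag j≢i)) (ℤP.*-zeroʳ (f j))))
                  (trans (cong (f i *_) (if-diag i)) (ℤP.*-identityʳ (f i)))

module _ {n : ℕ} where

  height-≈ : ∀ s w {z z′ : Point n} → z ≈ᵖ z′ → height s w z ≡ height s w z′
  height-≈ s w (x≗y , t≡s) =
    cong₂ (λ u v → + s * u - v) t≡s (Σ-cong n (λ j → cong (+ w j *_) (x≗y j)))

  height-+ᵖ : ∀ s w (z z′ : Point n) → height s w (z +ᵖ z′) ≡ height s w z + height s w z′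
  height-+ᵖ s w (x , t) (y , r) = begin
    + s * (t + r) - Σℤ n (λ j → + w j * (x j + y j))
      ≡⟨ cong (_-_ (+ s * (t + r))) (trans (Σ-cong n (λ j → ℤP.*-distribˡ-+ (+ w j) (x j) (y j))) (Σ-+ n _ _)) ⟩
    + s * (t + r) - (X + Y)
      ≡⟨ rearrange (+ s) t r X Y ⟩
    (+ s * t - X) + (+ s * r - Y) ∎
    where
    open ≡-Reasoning
    X Y : ℤ
    X = Σℤ n (λ j → + w j * x j)
    Y = Σℤ n (λ j → + w j * y j)
    rearrange : ∀ s t r X Y → s * (t + r) - (X + Y) ≡ (s * t - X) + (s * r - Y)
    rearrange = solve-∀

  height-·ᵖ : ∀ s w k (z : Point n) → height s w (k ·ᵖ z) ≡ k * height s w z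
  height-·ᵖ s w k (x , t) = begin
    + s * (k * t) - Σℤ n (λ j → + w j * (k * x j))
      ≡⟨ cong (_-_ (+ s * (k * t))) (trans (Σ-cong n (λ j → swap (+ w j) k (x j))) (Σ-*ˡ n k _)) ⟩
    + s * (k * t) - k * X
      ≡⟨ factor (+ s) k t X ⟩
    k * (+ s * t - X) ∎
    where
    open ≡-Reasoning
    X : ℤ
    X = Σℤ n (λ j → + w j * x j)
    swap : ∀ a k x → a * (k * x) ≡ k * (a * x)
    swap = solve-∀
    factor : ∀ s k t X → s * (k * t) - k * X ≡ k * (s * t - X)
    factor = solve-∀

  height-cong : ∀ {s s′} {w w′ : Fin n → ℕ} → s ≡ s′ → (∀ j → w j ≡ w′ j) → ∀ z →
                height s w z ≡ height s′ w′ z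
  height-cong {s} refl w≗w′ (x , t) = cong (_-_ (+ s * t)) (Σ-cong n (λ j → cong (λ v → + v * x j) (w≗w′ j)))

  height-+ʷ : ∀ s s′ (w w′ : Fin n → ℕ) z →
              height (s ℕ.+ s′) (λ j → w j ℕ.+ w′ j) z ≡ height s w z + height s′ w′ z
  height-+ʷ s s′ w w′ (x , t) = begin
    + (s ℕ.+ s′) * t - Σℤ n (λ j → + (w j ℕ.+ w′ j) * x j)
      ≡⟨ cong₂ (λ u v → u * t - v) (ℤP.pos-+ s s′) (trans (Σ-cong n distrib) (Σ-+ n _ _)) ⟩
    (+ s + + s′) * t - (X + X′)
      ≡⟨ rearrange (+ s) (+ s′) t X X′ ⟩
    (+ s * t - X) + (+ s′ * t - X′) ∎
    where
    open ≡-Reasoning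
    X X′ : ℤ
    X  = Σℤ n (λ j → + w j * x j)
    X′ = Σℤ n (λ j → + w′ j * x j)
    distrib : ∀ j → + (w j ℕ.+ w′ j) * x j ≡ + w j * x j + + w′ j * x j
    distrib j = trans (cong (_* x j) (ℤP.pos-+ (w j) (w′ j))) (ℤP.*-distribʳ-+ (x j) (+ w j) (+ w′ j))
    rearrange : ∀ s s′ t X X′ → (s + s′) * t - (X + X′) ≡ (s * t - X) + (s′ * t - X′)
    rearrange = solve-∀

  height-*ʷ : ∀ k s (w : Fin n → ℕ) z → height (k ℕ.* s) (λ j → k ℕ.* w j) z ≡ + k * height s w z
  height-*ʷ k s w (x , t) = begin
    + (k ℕ.* s) * t - Σℤ n (λ j → + (k ℕ.* w j) * x j)
      ≡⟨ cong₂ (λ u v → u * t - v) (ℤP.pos-* k s) (trans (Σ-cong n assoc) (Σ-*ˡ n (+ k) _)) ⟩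
    + k * + s * t - + k * X
      ≡⟨ factor (+ k) (+ s) t X ⟩
    + k * (+ s * t - X) ∎
    where
    open ≡-Reasoning
    X : ℤ
    X = Σℤ n (λ j → + w j * x j)
    assoc : ∀ j → + (k ℕ.* w j) * x j ≡ + k * (+ w j * x j)
    assoc j = trans (cong (_* x j) (ℤP.pos-* k (w j))) (ℤP.*-assoc (+ k) (+ w j) (x j))
    factor : ∀ k s t X → k * s * t - k * X ≡ k * (s * t - X)
    factor = solve-∀

  height-agreeExcept : ∀ s (i : Fin n) {w w′ : Fin n → ℕ} → (∀ j → ¬ j ≡ i → w j ≡ w′ j) → ∀ z →
                       height s w z ≡ height s w′ z + (+ w′ i - + w i) * σ i z
  height-agreeExcept s i {w} {w′} w≡w′ (x , t) = begin
    + s * t - Σℤ n (λ j → + w j * x j)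
      ≡⟨ cong (_-_ (+ s * t)) (Σ-agreeExcept n i _ _ (λ j j≢i → cong (λ v → + v * x j) (w≡w′ j j≢i))) ⟩
    + s * t - (X′ + (+ w i * x i - + w′ i * x i))
      ≡⟨ rearrange (+ s * t) X′ (+ w i) (+ w′ i) (x i) ⟩
    + s * t - X′ + (+ w′ i - + w i) * x i ∎
    where
    open ≡-Reasoning
    X′ : ℤ
    X′ = Σℤ n (λ j → + w′ j * x j)
    rearrange : ∀ T X a a′ y → T - (X + (a * y - a′ * y)) ≡ T - X + (a′ - a) * y
    rearrange = solve-∀

shiftᵛ : ∀ {n} → Fin n → ℤ → (Fin n → ℤ) → (Fin n → ℤ)
shiftᵛ i k x j = x j + k * δ i j

shift : ∀ {n} → Fin n → ℤ → Point n → Point n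
shift i k (x , t) = shiftᵛ i k x , t

module _ {n : ℕ} (i : Fin n) where

  σ-shift-diag : ∀ k (z : Point n) → σ i (shift i k z) ≡ σ i z + k
  σ-shift-diag k z = trans (cong (λ v → σ i z + k * v) (if-diag i)) (cong (_+_ (σ i z)) (ℤP.*-identityʳ k))

  σ-shift-offDiag : ∀ k (z : Point n) {j} → ¬ j ≡ i → σ j (shift i k z) ≡ σ j z
  σ-shift-offDiag k z {j} j≢i = trans (cong (λ v → σ j z + k * v) (if-offDiag j≢i)) (vanish (σ j z) k)
    where vanish : ∀ x k → x + k * + 0 ≡ x
          vanish = solve-∀

  height-shift : ∀ s w k (z : Point n) → height s w (shift i k z) ≡ height s w z - k * + w i
  height-shift s w k (x , t) = begin
    + s * t - Σℤ n (λ j → + w j * (x j + k * δ i j))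
      ≡⟨ cong (_-_ (+ s * t)) (trans (Σ-cong n expand) (Σ-+ n _ _)) ⟩
    + s * t - (X + Σℤ n (λ j → (k * + w j) * δ i j))
      ≡⟨ cong (λ v → + s * t - (X + v)) (Σ-δ n i (λ j → k * + w j)) ⟩
    + s * t - (X + k * + w i)
      ≡⟨ rearrange (+ s * t) X (k * + w i) ⟩
    + s * t - X - k * + w i ∎
    where
    open ≡-Reasoning
    X : ℤ
    X = Σℤ n (λ j → + w j * x j)
    expand : ∀ j → + w j * (x j + k * δ i j) ≡ + w j * x j + (k * + w j) * δ i j
    expand j = distrib (+ w j) (x j) k (δ i j)
      where distrib : ∀ a x k e → a * (x + k * e) ≡ a * x + (k * a) * e
            distrib = solve-∀
    rearrange : ∀ T X Y → T - (X + Y) ≡ T - X - Y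
    rearrange = solve-∀

  shift-≈ : ∀ k {z z′ : Point n} → z ≈ᵖ z′ → shift i k z ≈ᵖ shift i k z′
  shift-≈ k (x≗y , t≡s) = (λ j → cong (_+ k * δ i j) (x≗y j)) , t≡s

  shift-+ᵖ : ∀ k m (z w : Point n) → (shift i k z +ᵖ shift i m w) ≈ᵖ shift i (k + m) (z +ᵖ w)
  shift-+ᵖ k m (x , t) (y , s) = (λ j → rearrange (x j) (y j) k m (δ i j)) , refl
    where rearrange : ∀ x y k m e → (x + k * e) + (y + m * e) ≡ (x + y) + (k + m) * e
          rearrange = solve-∀

  shift-·ᵖ : ∀ k m (z : Point n) → (k ·ᵖ shift i m z) ≈ᵖ shift i (k * m) (k ·ᵖ z)
  shift-·ᵖ k m (x , t) = (λ j → distrib k (x j) m (δ i j)) , refl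
    where distrib : ∀ k x m e → k * (x + m * e) ≡ k * x + (k * m) * e
          distrib = solve-∀

  shift-shift : ∀ k m (z : Point n) → shift i m (shift i k z) ≈ᵖ shift i (k + m) z
  shift-shift k m (x , t) = (λ j → rearrange (x j) k m (δ i j)) , refl
    where rearrange : ∀ x k m e → (x + k * e) + m * e ≡ x + (k + m) * e
          rearrange = solve-∀

  shift-zero : ∀ (z : Point n) → shift i (+ 0) z ≈ᵖ z
  shift-zero (x , t) = (λ j → ℤP.+-identityʳ (x j)) , refl

  shift-inverse : ∀ k m → k + m ≡ + 0 → ∀ (z : Point n) → shift i m (shift i k z) ≈ᵖ z
  shift-inverse k m k+m≡0 z =
    ≈ᵖ-trans (shift-shift k m z) (≈ᵖ-trans (≈ᵖ-reflexive (cong (λ v → shift i v z) k+m≡0)) (shift-zero z))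

  shiftBy-≈ : (f : Point n → ℤ) → (∀ {z w} → z ≈ᵖ w → f z ≡ f w) →
              ∀ {z w} → z ≈ᵖ w → shift i (f z) z ≈ᵖ shift i (f w) w
  shiftBy-≈ f f-≈ {z} {w} z≈w = ≈ᵖ-trans (shift-≈ (f z) z≈w) (≈ᵖ-reflexive (cong (λ v → shift i v w) (f-≈ z≈w)))

height-0ᵖ : ∀ {n} s w → height {n} s w 0ᵖ ≡ + 0
height-0ᵖ s w = trans (height-·ᵖ s w (+ 0) 0ᵖ) (ℤP.*-zeroˡ (height s w 0ᵖ))

skewCoeff : ∀ {n} → (Fin n → ℕ) → Fin n → ℕ
skewCoeff μ j = Lcm μ div μ j

-- The cone and the semigroup Q(μ)

InCone : ∀ {n} → (Fin n → ℕ) → Point n → Set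
InCone μ z = (∀ j → + 0 ≤ σ j z) × (+ 0 ≤ σλ μ z)

module _ {n : ℕ} {μ : Fin n → ℕ} where

  private
    L : ℕ
    L = Lcm μ
    a : Fin n → ℕ
    a = skewCoeff μ

  InCone-≈ : ∀ {z w : Point n} → z ≈ᵖ w → InCone μ z → InCone μ w
  InCone-≈ z≈w (z≥0 , σλz≥0) =
    (λ j → subst (+ 0 ≤_) (proj₁ z≈w j) (z≥0 j)) , subst (+ 0 ≤_) (height-≈ L a z≈w) σλz≥0

  InCone-0ᵖ : InCone μ 0ᵖ
  InCone-0ᵖ = (λ _ → +≤+ ℕ.z≤n) , ℤP.≤-reflexive (sym (height-0ᵖ L a))

  InCone-+ᵖ : ∀ {z w : Point n} → InCone μ z → InCone μ w → InCone μ (z +ᵖ w)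
  InCone-+ᵖ {z} {w} (z≥0 , σλz≥0) (w≥0 , σλw≥0) =
    (λ j → +-nonNeg (z≥0 j) (w≥0 j)) , subst (+ 0 ≤_) (sym (height-+ᵖ L a z w)) (+-nonNeg σλz≥0 σλw≥0)

  InCone-cancel : ∀ k {z : Point n} → InCone μ ((+ ℕ.suc k) ·ᵖ z) → InCone μ z
  InCone-cancel k {z} (kz≥0 , σλkz≥0) =
    (λ j → *-cancelˡ-nonNeg {ℕ.suc k} (ℕ.s≤s ℕ.z≤n) (kz≥0 j)) ,
    *-cancelˡ-nonNeg {ℕ.suc k} (ℕ.s≤s ℕ.z≤n) (subst (+ 0 ≤_) (height-·ᵖ L a (+ ℕ.suc k) z) σλkz≥0)

  InSimplex⇒InCone : ∀ {p} → InSimplex μ p → InCone μ (gen p)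
  InSimplex⇒InCone {p} (p≥0 , Σ≤L) =
    p≥0 , subst (λ v → + 0 ≤ v - Σℤ n (λ j → + a j * p j)) (sym (ℤP.*-identityʳ (+ L))) (ℤP.i≤j⇒0≤j-i Σ≤L)

  InCone⇒InSimplex : ∀ {p} → InCone μ (gen p) → InSimplex μ p
  InCone⇒InSimplex {p} (p≥0 , σλ≥0) =
    p≥0 , ℤP.0≤i-j⇒j≤i (subst (λ v → + 0 ≤ v - Σℤ n (λ j → + a j * p j)) (ℤP.*-identityʳ (+ L)) σλ≥0)

  InCone-lower : ∀ i {t} {z : Point n} → InCone μ z → + 0 ≤ t → t ≤ σ i z → InCone μ (shift i (- t) z)
  InCone-lower i {t} {z} (z≥0 , σλz≥0) t≥0 t≤zᵢ = coords , σλ≥0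
    where
    coords : ∀ j → + 0 ≤ σ j (shift i (- t) z)
    coords = cases-≟ i (subst (+ 0 ≤_) (sym (σ-shift-diag i (- t) z)) (ℤP.i≤j⇒0≤j-i t≤zᵢ))
                       (λ {j} j≢i → subst (+ 0 ≤_) (sym (σ-shift-offDiag i (- t) z j≢i)) (z≥0 j))
    σλ≥0 : + 0 ≤ σλ μ (shift i (- t) z)
    σλ≥0 = subst (+ 0 ≤_) (sym (trans (height-shift i L a (- t) z) (negate (σλ μ z) t (+ a i))))
                 (+-nonNeg σλz≥0 (*-nonNeg t≥0 (+≤+ ℕ.z≤n)))
      where negate : ∀ s t a → s - (- t) * a ≡ s + t * a
            negate = solve-∀

  InQ-≈ : ∀ {z w : Point n} → z ≈ᵖ w → InQ μ z → InQ μ w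
  InQ-≈ z≈w (ps , ps∈Δ , Σps≈z) = ps , ps∈Δ , ≈ᵖ-trans Σps≈z z≈w

  InQ-0ᵖ : InQ μ 0ᵖ
  InQ-0ᵖ = [] , [] , ≈ᵖ-refl

  InQ-gen : ∀ {p} → InSimplex μ p → InQ μ (gen p)
  InQ-gen p∈Δ = (_ ∷ []) , (p∈Δ ∷ []) , ((λ j → ℤP.+-identityʳ _) , ℤP.+-identityʳ _)

  InQ-+ᵖ : ∀ {z w : Point n} → InQ μ z → InQ μ w → InQ μ (z +ᵖ w)
  InQ-+ᵖ (ps , ps∈Δ , Σps≈z) (qs , qs∈Δ , Σqs≈w) =
    ps ++ qs , ++⁺ ps∈Δ qs∈Δ , ≈ᵖ-trans (sumᵖ-++ ps qs) (+ᵖ-cong Σps≈z Σqs≈w)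
    where
    sumᵖ-++ : ∀ ps qs → sumᵖ (map gen (ps ++ qs)) ≈ᵖ (sumᵖ (map gen ps) +ᵖ sumᵖ (map gen qs))
    sumᵖ-++ []       qs = (λ j → sym (ℤP.+-identityˡ _)) , sym (ℤP.+-identityˡ _)
    sumᵖ-++ (p ∷ ps) qs = ≈ᵖ-trans (+ᵖ-cong (≈ᵖ-refl {z = gen p}) (sumᵖ-++ ps qs))
      ((λ j → sym (ℤP.+-assoc (p j) (σ j (sumᵖ (map gen ps))) (σ j (sumᵖ (map gen qs))))) ,
       sym (ℤP.+-assoc (+ 1) (proj₂ (sumᵖ (map gen ps))) (proj₂ (sumᵖ (map gen qs)))))

  InQ-·ᵖ : ∀ {k} {z : Point n} → + 0 ≤ k → InQ μ z → InQ μ (k ·ᵖ z)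
  InQ-·ᵖ {+ m} _ = multiple m
    where
    multiple : ∀ m {z} → InQ μ z → InQ μ ((+ m) ·ᵖ z)
    multiple ℕ.zero    {z} _  = InQ-≈ ((λ j → sym (ℤP.*-zeroˡ (σ j z))) , sym (ℤP.*-zeroˡ (proj₂ z))) InQ-0ᵖ
    multiple (ℕ.suc m) {z} z∈Q = InQ-≈ ((λ j → unfold (+ m) (σ j z)) , unfold (+ m) (proj₂ z))
                                       (InQ-+ᵖ z∈Q (multiple m z∈Q))
      where unfold : ∀ m x → x + m * x ≡ (+ 1 + m) * x
            unfold = solve-∀

  InQ-Σᵖ : ∀ m (f : Fin m → Point n) → (∀ j → InQ μ (f j)) → InQ μ (Σᵖ m f)
  InQ-Σᵖ ℕ.zero    f _     = InQ-0ᵖ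
  InQ-Σᵖ (ℕ.suc m) f f∈Q = InQ-+ᵖ (f∈Q zero) (InQ-Σᵖ m _ (λ j → f∈Q (suc j)))

  InQ⇒InCone : ∀ {z : Point n} → InQ μ z → InCone μ z
  InQ⇒InCone (ps , ps∈Δ , Σps≈z) = InCone-≈ Σps≈z (sum∈cone ps∈Δ)
    where
    sum∈cone : ∀ {ps} → All (InSimplex μ) ps → InCone μ (sumᵖ (map gen ps))
    sum∈cone []           = InCone-0ᵖ
    sum∈cone (p∈Δ ∷ ps∈Δ) = InCone-+ᵖ (InSimplex⇒InCone p∈Δ) (sum∈cone ps∈Δ)

  InQbar⇒InCone : ∀ {z : Point n} → InQbar μ z → InCone μ z
  InQbar⇒InCone (k , kz∈Q) = InCone-cancel k (InQ⇒InCone kz∈Q)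

  InQ-lower : ∀ i {t} {z : Point n} → + 0 ≤ t → t ≤ σ i z → InQ μ z → InQ μ (shift i (- t) z)
  InQ-lower i {t} t≥0 t≤zᵢ (ps , ps∈Δ , Σps≈z) =
    InQ-≈ (shift-≈ i (- t) Σps≈z) (lowerSum ps ps∈Δ t t≥0 (subst (t ≤_) (sym (proj₁ Σps≈z i)) t≤zᵢ))
    where
    lowerGen : ∀ {p} r → InSimplex μ p → + 0 ≤ r → r ≤ p i → InQ μ (shift i (- r) (gen p))
    lowerGen r p∈Δ r≥0 r≤pᵢ = InQ-gen (InCone⇒InSimplex (InCone-lower i (InSimplex⇒InCone p∈Δ) r≥0 r≤pᵢ))
    combine : ∀ t r (z w : Point n) → InQ μ (shift i (- r) z) → InQ μ (shift i (- (t - r)) w) →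
              InQ μ (shift i (- t) (z +ᵖ w))
    combine t r z w z′∈Q w′∈Q =
      InQ-≈ (≈ᵖ-trans (shift-+ᵖ i (- r) (- (t - r)) z w) (≈ᵖ-reflexive (cong (λ k → shift i k (z +ᵖ w)) (regroup r t))))
            (InQ-+ᵖ z′∈Q w′∈Q)
      where regroup : ∀ r t → - r + - (t - r) ≡ - t
            regroup = solve-∀
    lowerSum : ∀ ps → All (InSimplex μ) ps → ∀ t → + 0 ≤ t → t ≤ σ i (sumᵖ (map gen ps)) →
               InQ μ (shift i (- t) (sumᵖ (map gen ps)))
    lowerSum []       []           t t≥0 t≤0 rewrite ℤP.≤-antisym t≤0 t≥0 = InQ-≈ (≈ᵖ-sym (shift-zero i 0ᵖ)) InQ-0ᵖ
    lowerSum (p ∷ ps) (p∈Δ ∷ ps∈Δ) t t≥0 t≤Σᵢ with t ℤP.≤? p i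
    ... | yes t≤pᵢ = combine t t (gen p) S (lowerGen t p∈Δ t≥0 t≤pᵢ)
                       (InQ-≈ (≈ᵖ-trans (≈ᵖ-sym (shift-zero i S)) (≈ᵖ-reflexive (cong (λ k → shift i k S) (sym (vanish t)))))
                              (ps , ps∈Δ , ≈ᵖ-refl))
      where S : Point n
            S = sumᵖ (map gen ps)
            vanish : ∀ t → - (t - t) ≡ + 0
            vanish = solve-∀
    ... | no t≰pᵢ = combine t (p i) (gen p) (sumᵖ (map gen ps)) (lowerGen (p i) p∈Δ (proj₁ p∈Δ i) ℤP.≤-refl)
                      (lowerSum ps ps∈Δ (t - p i) (ℤP.i≤j⇒0≤j-i (ℤP.<⇒≤ (ℤP.≰⇒> t≰pᵢ)))
                                (ℤP.0≤i-j⇒j≤i (subst (+ 0 ≤_) (regroup (p i) (σ i (sumᵖ (map gen ps))) t)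
                                                     (ℤP.i≤j⇒0≤j-i t≤Σᵢ))))
      where regroup : ∀ a b t → a + b - t ≡ b - (t - a)
            regroup = solve-∀

  InQbar-≈ : ∀ {z w : Point n} → z ≈ᵖ w → InQbar μ z → InQbar μ w
  InQbar-≈ z≈w (k , kz∈Q) = k , InQ-≈ (·ᵖ-cong (+ ℕ.suc k) z≈w) kz∈Q

  IsHole-≈ : ∀ {z w : Point n} → z ≈ᵖ w → IsHole μ z → IsHole μ w
  IsHole-≈ z≈w (z∈Q̄ , z∉Q) = InQbar-≈ z≈w z∈Q̄ , z∉Q ∘ InQ-≈ (≈ᵖ-sym z≈w)

InQ-image : ∀ {n} {μ ν : Fin n → ℕ} {α : Point n → Point n} → IsLinear α →
            (∀ {z w} → z ≈ᵖ w → α z ≈ᵖ α w) → (∀ {p} → InSimplex μ p → InQ ν (α (gen p))) →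
            ∀ {z} → InQ μ z → InQ ν (α z)
InQ-image {μ = μ} {ν} {α} (α-+ᵖ , α-·ᵖ) α-≈ α[gen]∈Q (ps , ps∈Δ , Σps≈z) = InQ-≈ (α-≈ Σps≈z) (image ps∈Δ)
  where
  α0≈0 : α 0ᵖ ≈ᵖ 0ᵖ
  α0≈0 = ≈ᵖ-trans (α-·ᵖ (+ 0) 0ᵖ) ((λ j → ℤP.*-zeroˡ (σ j (α 0ᵖ))) , ℤP.*-zeroˡ (proj₂ (α 0ᵖ)))
  image : ∀ {ps} → All (InSimplex μ) ps → InQ ν (α (sumᵖ (map gen ps)))
  image []                     = InQ-≈ (≈ᵖ-sym α0≈0) InQ-0ᵖ
  image {p ∷ ps} (p∈Δ ∷ ps∈Δ) =
    InQ-≈ (≈ᵖ-sym (α-+ᵖ (gen p) (sumᵖ (map gen ps)))) (InQ-+ᵖ (α[gen]∈Q p∈Δ) (image ps∈Δ))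

module _ {n : ℕ} {μ : Fin n → ℕ} (μ>0 : Positive μ) where

  private
    L : ℕ
    L = Lcm μ
    a : Fin n → ℕ
    a = skewCoeff μ

  Lcm-pos : 0 ℕ.< Lcm μ
  Lcm-pos = lcmF-pos n μ μ>0

  skewCoeff*λ : ∀ j → skewCoeff μ j ℕ.* μ j ≡ Lcm μ
  skewCoeff*λ j = div-exact (μ>0 j) (lcmF-∣ n μ j)

  vertex : Fin n → (Fin n → ℤ)
  vertex j k = + μ j * δ j k

  vertex∈Δ : ∀ j → InSimplex μ (vertex j)
  vertex∈Δ j = (λ k → pos*-nonNeg (μ j) (δ-nonNeg j k)) , ℤP.≤-reflexive (begin
    Σℤ n (λ k → + a k * (+ μ j * δ j k))   ≡⟨ Σ-cong n (λ k → sym (ℤP.*-assoc (+ a k) (+ μ j) (δ j k))) ⟩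
    Σℤ n (λ k → + a k * + μ j * δ j k)     ≡⟨ Σ-δ n j (λ k → + a k * + μ j) ⟩
    + a j * + μ j                          ≡⟨ sym (ℤP.pos-* (a j) (μ j)) ⟩
    + (a j ℕ.* μ j)                        ≡⟨ cong +_ (skewCoeff*λ j) ⟩
    + L                                    ∎)
    where open ≡-Reasoning

  origin∈Δ : InSimplex μ (λ _ → + 0)
  origin∈Δ = (λ _ → +≤+ ℕ.z≤n) ,
             subst (_≤ + L) (sym (trans (Σ-cong n (λ j → ℤP.*-zeroʳ (+ a j))) (Σ-zero n))) (+≤+ ℕ.z≤n)

  -- L z = σλ(z) (0, 1) + Σⱼ (L/λⱼ) zⱼ (λⱼ eⱼ, 1).
  InCone⇒InQbar : ∀ {z : Point n} → InCone μ z → InQbar μ z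
  InCone⇒InQbar {x , t} (x≥0 , σλ≥0) =
    ℕ.pred L , InQ-≈ (≈ᵖ-trans P≈Lz (≈ᵖ-reflexive (cong (λ m → (+ m) ·ᵖ (x , t)) (sym 1+[L-1]≡L)))) P∈Q
    where
    1+[L-1]≡L : ℕ.suc (ℕ.pred L) ≡ L
    1+[L-1]≡L = ℕP.suc-pred L {{ℕ.>-nonZero Lcm-pos}}
    P : Point n
    P = (σλ μ (x , t) ·ᵖ gen (λ _ → + 0)) +ᵖ Σᵖ n (λ j → (+ a j * x j) ·ᵖ gen (vertex j))
    P∈Q : InQ μ P
    P∈Q = InQ-+ᵖ (InQ-·ᵖ σλ≥0 (InQ-gen origin∈Δ))
                 (InQ-Σᵖ n _ (λ j → InQ-·ᵖ (pos*-nonNeg (a j) (x≥0 j)) (InQ-gen (vertex∈Δ j))))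
    coord : ∀ k → σλ μ (x , t) * + 0 + σ k (Σᵖ n (λ j → (+ a j * x j) ·ᵖ gen (vertex j))) ≡ + L * x k
    coord k = begin
      σλ μ (x , t) * + 0 + σ k (Σᵖ n _)             ≡⟨ cong₂ _+_ (ℤP.*-zeroʳ (σλ μ (x , t))) (σ-Σᵖ n _ k) ⟩
      + 0 + Σℤ n (λ j → (+ a j * x j) * (+ μ j * δ j k))
        ≡⟨ trans (ℤP.+-identityˡ _) (Σ-cong n (λ j → trans (cong (λ v → (+ a j * x j) * (+ μ j * v)) (δ-sym j k))
                                                           (regroup (+ a j) (x j) (+ μ j) (δ k j)))) ⟩
      Σℤ n (λ j → (+ a j * + μ j) * x j * δ k j)   ≡⟨ Σ-δ n k (λ j → (+ a j * + μ j) * x j) ⟩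
      (+ a k * + μ k) * x k                          ≡⟨ cong (_* x k) (trans (sym (ℤP.pos-* (a k) (μ k))) (cong +_ (skewCoeff*λ k))) ⟩
      + L * x k                                      ∎
      where
      open ≡-Reasoning
      regroup : ∀ a x m e → (a * x) * (m * e) ≡ (a * m) * x * e
      regroup = solve-∀
    last : σλ μ (x , t) * + 1 + proj₂ (Σᵖ n (λ j → (+ a j * x j) ·ᵖ gen (vertex j))) ≡ + L * t
    last = begin
      σλ μ (x , t) * + 1 + proj₂ (Σᵖ n _)          ≡⟨ cong (_+_ (σλ μ (x , t) * + 1)) (last-Σᵖ n _) ⟩
      σλ μ (x , t) * + 1 + Σℤ n (λ j → (+ a j * x j) * + 1)
        ≡⟨ cong (_+_ (σλ μ (x , t) * + 1)) (Σ-cong n (λ j → ℤP.*-identityʳ (+ a j * x j))) ⟩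
      (+ L * t - X) * + 1 + X                        ≡⟨ cancel (+ L * t) X ⟩
      + L * t                                        ∎
      where
      open ≡-Reasoning
      X : ℤ
      X = Σℤ n (λ j → + a j * x j)
      cancel : ∀ T X → (T - X) * + 1 + X ≡ T
      cancel = solve-∀
    P≈Lz : P ≈ᵖ ((+ L) ·ᵖ (x , t))
    P≈Lz = coord , last

-- The transformation α

module Transform {n : ℕ} (lam : Fin n → ℕ) (lam>0 : Positive lam) (i : Fin n) where

  lam′ : Fin n → ℕ
  lam′ = lamPrime lam i

  ℓ d : ℕ
  ℓ = lcmExcept lam i
  d = skewCoeff lam i

  -- b i = 0: c does not see the i-th coordinate, so shifting along eᵢ by −c undoes α.
  b : Fin n → ℕ
  b j = if does (j ≟ i) then 0 else ℓ div lam j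

  c : Point n → ℤ
  c = height ℓ b

  α β : Point n → Point n
  α z = shift i (c z) z
  β z = shift i (- c z) z

  ℓ>0 : 0 ℕ.< ℓ
  ℓ>0 = lcmF-pos n _ positive
    where
    positive : ∀ j → 0 ℕ.< (if does (j ≟ i) then 1 else lam j)
    positive j with j ≟ i
    ... | yes _ = ℕ.s≤s ℕ.z≤n
    ... | no _  = lam>0 j

  b*λ≡ℓ : ∀ {j} → ¬ j ≡ i → b j ℕ.* lam j ≡ ℓ
  b*λ≡ℓ {j} j≢i = trans (cong (ℕ._* lam j) (if-offDiag j≢i)) (div-exact (lam>0 j) (lcmExcept-∣ lam j≢i))

  L≡d*λᵢ : Lcm lam ≡ d ℕ.* lam i
  L≡d*λᵢ = sym (skewCoeff*λ lam>0 i)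

  L′≡d*λ′ᵢ : Lcm lam′ ≡ d ℕ.* lam′ i
  L′≡d*λ′ᵢ = begin
    Lcm lam′                              ≡⟨ lcmF-split n lam′ i ⟩
    lcm (lcmExcept lam′ i) (lam′ i)       ≡⟨ cong₂ lcm (lcmF-cong n sameExcept) (if-diag i) ⟩
    lcm ℓ (lam i ℕ.+ ℓ)                   ≡⟨ lcm-shift ℓ (lam i) d (lam>0 i) (trans (sym (lcmF-split n lam i)) L≡d*λᵢ) ⟩
    d ℕ.* (lam i ℕ.+ ℓ)                   ≡⟨ cong (d ℕ.*_) (sym (if-diag i)) ⟩
    d ℕ.* lam′ i                          ∎
    where
    open ≡-Reasoning
    sameExcept : ∀ j → (if does (j ≟ i) then 1 else lam′ j) ≡ (if does (j ≟ i) then 1 else lam j)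
    sameExcept j with j ≟ i
    ... | yes _ = refl
    ... | no _  = refl

  L′≡L+d*ℓ : Lcm lam′ ≡ Lcm lam ℕ.+ d ℕ.* ℓ
  L′≡L+d*ℓ = trans L′≡d*λ′ᵢ (trans (cong (d ℕ.*_) (if-diag i))
                   (trans (ℕP.*-distribˡ-+ d (lam i) ℓ) (cong (ℕ._+ d ℕ.* ℓ) (sym L≡d*λᵢ))))

  skewCoeff′-diag : skewCoeff lam′ i ≡ d
  skewCoeff′-diag = div-unique λ′ᵢ>0 L′≡d*λ′ᵢ
    where λ′ᵢ>0 : 0 ℕ.< lam′ i
          λ′ᵢ>0 = subst (0 ℕ.<_) (sym (if-diag i)) (ℕP.<-≤-trans (lam>0 i) (ℕP.m≤m+n (lam i) ℓ))

  skewCoeff′ : ∀ j → skewCoeff lam′ j ≡ skewCoeff lam j ℕ.+ d ℕ.* b j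
  skewCoeff′ = cases-≟ i diag offDiag
    where
    diag : skewCoeff lam′ i ≡ skewCoeff lam i ℕ.+ d ℕ.* b i
    diag = begin
      skewCoeff lam′ i   ≡⟨ skewCoeff′-diag ⟩
      d                  ≡⟨ sym (ℕP.+-identityʳ d) ⟩
      d ℕ.+ 0            ≡⟨ cong (d ℕ.+_) (sym (trans (cong (d ℕ.*_) (if-diag i)) (ℕP.*-zeroʳ d))) ⟩
      d ℕ.+ d ℕ.* b i    ∎
      where open ≡-Reasoning
    offDiag : ∀ {j} → ¬ j ≡ i → skewCoeff lam′ j ≡ skewCoeff lam j ℕ.+ d ℕ.* b j
    offDiag {j} j≢i = trans (cong (Lcm lam′ div_) (if-offDiag j≢i)) (div-unique (lam>0 j) (begin
      Lcm lam′
        ≡⟨ L′≡L+d*ℓ ⟩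
      Lcm lam ℕ.+ d ℕ.* ℓ
        ≡⟨ cong₂ (λ u v → u ℕ.+ d ℕ.* v) (sym (skewCoeff*λ lam>0 j)) (sym (b*λ≡ℓ j≢i)) ⟩
      skewCoeff lam j ℕ.* lam j ℕ.+ d ℕ.* (b j ℕ.* lam j)
        ≡⟨ factor (skewCoeff lam j) d (b j) (lam j) ⟩
      (skewCoeff lam j ℕ.+ d ℕ.* b j) ℕ.* lam j ∎))
      where
      open ≡-Reasoning
      factor : ∀ a d b m → a ℕ.* m ℕ.+ d ℕ.* (b ℕ.* m) ≡ (a ℕ.+ d ℕ.* b) ℕ.* m
      factor = ℕSolver.solve-∀

  L*b≡ℓ*a : ∀ {j} → ¬ j ≡ i → Lcm lam ℕ.* b j ≡ ℓ ℕ.* skewCoeff lam j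
  L*b≡ℓ*a {j} j≢i = begin
    Lcm lam ℕ.* b j                         ≡⟨ cong (ℕ._* b j) (sym (skewCoeff*λ lam>0 j)) ⟩
    skewCoeff lam j ℕ.* lam j ℕ.* b j       ≡⟨ rearrange (skewCoeff lam j) (lam j) (b j) ⟩
    b j ℕ.* lam j ℕ.* skewCoeff lam j       ≡⟨ cong (ℕ._* skewCoeff lam j) (b*λ≡ℓ j≢i) ⟩
    ℓ ℕ.* skewCoeff lam j                   ∎
    where
    open ≡-Reasoning
    rearrange : ∀ a m b → a ℕ.* m ℕ.* b ≡ b ℕ.* m ℕ.* a
    rearrange = ℕSolver.solve-∀

  c-shift : ∀ k z → c (shift i k z) ≡ c z
  c-shift k z = begin
    c (shift i k z)       ≡⟨ height-shift i ℓ b k z ⟩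
    c z - k * + b i       ≡⟨ cong (λ v → c z - k * + v) (if-diag i) ⟩
    c z - k * + 0         ≡⟨ vanish (c z) k ⟩
    c z                   ∎
    where
    open ≡-Reasoning
    vanish : ∀ x k → x - k * + 0 ≡ x
    vanish = solve-∀

  σλ′≡σλ+d*c : ∀ z → σλ lam′ z ≡ σλ lam z + + d * c z
  σλ′≡σλ+d*c z = begin
    σλ lam′ z                                                      ≡⟨ height-cong L′≡L+d*ℓ skewCoeff′ z ⟩
    height (Lcm lam ℕ.+ d ℕ.* ℓ) (λ j → skewCoeff lam j ℕ.+ d ℕ.* b j) z
                                                                   ≡⟨ height-+ʷ (Lcm lam) (d ℕ.* ℓ) (skewCoeff lam) _ z ⟩
    σλ lam z + height (d ℕ.* ℓ) (λ j → d ℕ.* b j) z               ≡⟨ cong (_+_ (σλ lam z)) (height-*ʷ d ℓ b z) ⟩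
    σλ lam z + + d * c z                                           ∎
    where open ≡-Reasoning

  σλ′-α : ∀ z → σλ lam′ (α z) ≡ σλ lam z
  σλ′-α z = begin
    σλ lam′ (α z)                                  ≡⟨ height-shift i (Lcm lam′) (skewCoeff lam′) (c z) z ⟩
    σλ lam′ z - c z * + skewCoeff lam′ i           ≡⟨ cong₂ (λ u v → u - c z * + v) (σλ′≡σλ+d*c z) skewCoeff′-diag ⟩
    σλ lam z + + d * c z - c z * + d               ≡⟨ cancel (σλ lam z) (+ d) (c z) ⟩
    σλ lam z                                       ∎
    where
    open ≡-Reasoning
    cancel : ∀ s d c → s + d * c - c * d ≡ s
    cancel = solve-∀

  L*c≡ℓ*[σλ+d*σᵢ] : ∀ z → + Lcm lam * c z ≡ + ℓ * (σλ lam z + + d * σ i z)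
  L*c≡ℓ*[σλ+d*σᵢ] z = begin
    + Lcm lam * c z
      ≡⟨ sym (height-*ʷ (Lcm lam) ℓ b z) ⟩
    height (Lcm lam ℕ.* ℓ) (λ j → Lcm lam ℕ.* b j) z
      ≡⟨ height-agreeExcept (Lcm lam ℕ.* ℓ) i (λ _ → L*b≡ℓ*a) z ⟩
    height (Lcm lam ℕ.* ℓ) (λ j → ℓ ℕ.* skewCoeff lam j) z + (+ (ℓ ℕ.* d) - + (Lcm lam ℕ.* b i)) * σ i z
      ≡⟨ cong₂ (λ u v → u + (+ (ℓ ℕ.* d) - + v) * σ i z)
               (trans (height-cong {w = λ j → ℓ ℕ.* skewCoeff lam j} (ℕP.*-comm (Lcm lam) ℓ) (λ _ → refl) z)
                      (height-*ʷ ℓ (Lcm lam) (skewCoeff lam) z))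
               (trans (cong (Lcm lam ℕ.*_) (if-diag i)) (ℕP.*-zeroʳ (Lcm lam))) ⟩
    + ℓ * σλ lam z + (+ (ℓ ℕ.* d) - + 0) * σ i z
      ≡⟨ cong (λ v → + ℓ * σλ lam z + (v - + 0) * σ i z) (ℤP.pos-* ℓ d) ⟩
    + ℓ * σλ lam z + (+ ℓ * + d - + 0) * σ i z
      ≡⟨ factor (+ ℓ) (σλ lam z) (+ d) (σ i z) ⟩
    + ℓ * (σλ lam z + + d * σ i z)
      ∎
    where
    open ≡-Reasoning
    factor : ∀ l s d x → l * s + (l * d - + 0) * x ≡ l * (s + d * x)
    factor = solve-∀

  c-nonNeg : ∀ {z} → InCone lam z → + 0 ≤ c z
  c-nonNeg {z} (z≥0 , σλ≥0) = *-cancelˡ-nonNeg {Lcm lam} (Lcm-pos lam>0)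
    (subst (+ 0 ≤_) (sym (L*c≡ℓ*[σλ+d*σᵢ] z)) (pos*-nonNeg ℓ (+-nonNeg σλ≥0 (pos*-nonNeg d (z≥0 i)))))

  c-pos : ∀ {z} → InCone lam z → + 0 < σλ lam z → + 0 < c z
  c-pos {z} (z≥0 , _) σλ>0 = *-cancelˡ-pos {Lcm lam}
    (subst (+ 0 <_) (sym (L*c≡ℓ*[σλ+d*σᵢ] z)) (*-pos (+<+ ℓ>0) (+-pos-nonNeg σλ>0 (pos*-nonNeg d (z≥0 i)))))

  σ-α-offDiag : ∀ z j → ¬ j ≡ i → σ j (α z) ≡ σ j z
  σ-α-offDiag z j = σ-shift-offDiag i (c z) z

  α-≈ : ∀ {z w} → z ≈ᵖ w → α z ≈ᵖ α w
  α-≈ = shiftBy-≈ i c (height-≈ ℓ b)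

  α-linear : IsLinear α
  α-linear = α-+ᵖ , α-·ᵖ
    where
    α-+ᵖ : ∀ z w → α (z +ᵖ w) ≈ᵖ (α z +ᵖ α w)
    α-+ᵖ z w = ≈ᵖ-trans (≈ᵖ-reflexive (cong (λ k → shift i k (z +ᵖ w)) (height-+ᵖ ℓ b z w)))
                        (≈ᵖ-sym (shift-+ᵖ i (c z) (c w) z w))
    α-·ᵖ : ∀ k z → α (k ·ᵖ z) ≈ᵖ (k ·ᵖ α z)
    α-·ᵖ k z = ≈ᵖ-trans (≈ᵖ-reflexive (cong (λ v → shift i v (k ·ᵖ z)) (height-·ᵖ ℓ b k z)))
                        (≈ᵖ-sym (shift-·ᵖ i k (c z) z))

  β-α : ∀ z → β (α z) ≈ᵖ z
  β-α z = shift-inverse i (c z) (- c (α z)) (trans (cong (λ v → c z - v) (c-shift (c z) z)) (ℤP.+-inverseʳ (c z))) z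

  α-β : ∀ z → α (β z) ≈ᵖ z
  α-β z = shift-inverse i (- c z) (c (β z)) (trans (cong (λ v → - c z + v) (c-shift (- c z) z)) (ℤP.+-inverseˡ (c z))) z

  α-bijective : IsBijective α
  α-bijective = injective , λ w → β w , α-β w
    where
    injective : ∀ z w → α z ≈ᵖ α w → z ≈ᵖ w
    injective z w αz≈αw =
      ≈ᵖ-trans (≈ᵖ-sym (β-α z)) (≈ᵖ-trans (shiftBy-≈ i (-_ ∘ c) (cong -_ ∘ height-≈ ℓ b) αz≈αw) (β-α w))

  α-InCone : ∀ {z} → InCone lam z → InCone lam′ (α z)
  α-InCone {z} z∈C@(z≥0 , σλ≥0) = cases-≟ i diag offDiag , subst (+ 0 ≤_) (sym (σλ′-α z)) σλ≥0
    where
    diag : + 0 ≤ σ i (α z)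
    diag = subst (+ 0 ≤_) (sym (σ-shift-diag i (c z) z)) (+-nonNeg (z≥0 i) (c-nonNeg z∈C))
    offDiag : ∀ {j} → ¬ j ≡ i → + 0 ≤ σ j (α z)
    offDiag {j} j≢i = subst (+ 0 ≤_) (sym (σ-α-offDiag z j j≢i)) (z≥0 j)

  InQ-α : ∀ {z} → InQ lam z → InQ lam′ (α z)
  InQ-α = InQ-image α-linear α-≈ (λ p∈Δ → InQ-gen (InCone⇒InSimplex (α-InCone (InSimplex⇒InCone p∈Δ))))

  module _ (noHoles : NoBoundaryHoles lam) where

    c-pos-hole : ∀ {z} → IsHole lam z → + 0 < c z
    c-pos-hole {z} z-hole@(z∈Q̄ , _) =
      c-pos z∈C (ℤP.≤∧≢⇒< (proj₂ z∈C) (λ 0≡σλ → noHoles z z-hole (inj₂ (sym 0≡σλ))))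
      where z∈C : InCone lam z
            z∈C = InQbar⇒InCone z∈Q̄

    σᵢ-increases : ∀ z → IsHole lam z → σ i z < σ i (α z)
    σᵢ-increases z z-hole = subst₂ _<_ (ℤP.+-identityʳ (σ i z)) (sym (σ-shift-diag i (c z) z))
                                   (ℤP.+-monoʳ-< (σ i z) (c-pos-hole z-hole))

    -- u is z projected to the facet σᵢ = 0, a boundary point of the cone of λ; so u ∈ Q(λ)
    -- by hypothesis, and α z is α u lowered along eᵢ by −σᵢ z.
    InQ′-α-of-σᵢ≤0 : ∀ {z} → (∀ {j} → ¬ j ≡ i → + 0 ≤ σ j z) → σ i z ≤ + 0 → + 0 ≤ σ i (α z) →
                     ¬ ¬ InQ lam′ (α z)
    InQ′-α-of-σᵢ≤0 {z} z≥0 zᵢ≤0 αzᵢ≥0 αz∉Q′ = noHoles u (InCone⇒InQbar lam>0 u∈C , u∉Q) (inj₁ (i , uᵢ≡0))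
      where
      u : Point n
      u = shift i (- σ i z) z
      uᵢ≡0 : σ i u ≡ + 0
      uᵢ≡0 = trans (σ-shift-diag i (- σ i z) z) (ℤP.+-inverseʳ (σ i z))
      αzᵢ≡zᵢ+c : σ i (α z) ≡ σ i z + c z
      αzᵢ≡zᵢ+c = σ-shift-diag i (c z) z
      -zᵢ≤c : - σ i z ≤ c z
      -zᵢ≤c = ℤP.0≤i-j⇒j≤i (subst (+ 0 ≤_) (trans αzᵢ≡zᵢ+c (rearrange (σ i z) (c z))) αzᵢ≥0)
        where rearrange : ∀ x c → x + c ≡ c - - x
              rearrange = solve-∀
      c≥0 : + 0 ≤ c z
      c≥0 = ℤP.≤-trans (ℤP.neg-mono-≤ zᵢ≤0) -zᵢ≤c
      u∈C : InCone lam u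
      u∈C = cases-≟ i (ℤP.≤-reflexive (sym uᵢ≡0))
                      (λ {j} j≢i → subst (+ 0 ≤_) (sym (σ-shift-offDiag i (- σ i z) z j≢i)) (z≥0 j≢i)) ,
            *-cancelˡ-nonNeg ℓ>0 (subst (+ 0 ≤_) ℓσλu≡Lc (pos*-nonNeg (Lcm lam) c≥0))
        where
        ℓσλu≡Lc : + Lcm lam * c z ≡ + ℓ * σλ lam u
        ℓσλu≡Lc = begin
          + Lcm lam * c z                      ≡⟨ cong (+ Lcm lam *_) (sym (c-shift (- σ i z) z)) ⟩
          + Lcm lam * c u                      ≡⟨ L*c≡ℓ*[σλ+d*σᵢ] u ⟩
          + ℓ * (σλ lam u + + d * σ i u)       ≡⟨ cong (λ v → + ℓ * (σλ lam u + + d * v)) uᵢ≡0 ⟩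
          + ℓ * (σλ lam u + + d * + 0)         ≡⟨ cong (λ v → + ℓ * v) (vanish (σλ lam u) (+ d)) ⟩
          + ℓ * σλ lam u                       ∎
          where
          open ≡-Reasoning
          vanish : ∀ s d → s + d * + 0 ≡ s
          vanish = solve-∀
      αu≈ : shift i (- - σ i z) (α u) ≈ᵖ α z
      αu≈ = ≈ᵖ-trans (shift-≈ i (- - σ i z) (shift-shift i (- σ i z) (c u) z))
           (≈ᵖ-trans (shift-shift i (- σ i z + c u) (- - σ i z) z)
                     (≈ᵖ-reflexive (cong (λ v → shift i v z) (trans (cong (λ v → - σ i z + v + - - σ i z) (c-shift (- σ i z) z))
                                                                      (cancel (σ i z) (c z))))))
        where cancel : ∀ x c → - x + c + - - x ≡ c
              cancel = solve-∀
      u∉Q : ¬ InQ lam u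
      u∉Q u∈Q = αz∉Q′ (InQ-≈ αu≈ (InQ-lower i (ℤP.neg-mono-≤ zᵢ≤0) -zᵢ≤αuᵢ (InQ-α u∈Q)))
        where
        -zᵢ≤αuᵢ : - σ i z ≤ σ i (α u)
        -zᵢ≤αuᵢ = subst (- σ i z ≤_) (sym αuᵢ≡c) -zᵢ≤c
          where αuᵢ≡c : σ i (α u) ≡ c z
                αuᵢ≡c = trans (σ-shift-diag i (c u) u)
                              (trans (cong₂ _+_ uᵢ≡0 (c-shift (- σ i z) z)) (ℤP.+-identityˡ (c z)))

    IsHole-pullback : ∀ z → IsHole lam′ (α z) → IsHole lam z
    IsHole-pullback z (αz∈Q̄′ , αz∉Q′) = z∈Q̄ , αz∉Q′ ∘ InQ-α
      where
      αz∈C′ : InCone lam′ (α z)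
      αz∈C′ = InQbar⇒InCone αz∈Q̄′
      zⱼ≥0 : ∀ {j} → ¬ j ≡ i → + 0 ≤ σ j z
      zⱼ≥0 {j} j≢i = subst (+ 0 ≤_) (σ-α-offDiag z j j≢i) (proj₁ αz∈C′ j)
      σλ≥0 : + 0 ≤ σλ lam z
      σλ≥0 = subst (+ 0 ≤_) (σλ′-α z) (proj₂ αz∈C′)
      z∈Q̄ : InQbar lam z
      z∈Q̄ with + 0 ℤP.≤? σ i z
      ... | yes zᵢ≥0 = InCone⇒InQbar lam>0 (cases-≟ i zᵢ≥0 zⱼ≥0 , σλ≥0)
      ... | no zᵢ≱0  = contradiction αz∉Q′ (InQ′-α-of-σᵢ≤0 zⱼ≥0 (ℤP.<⇒≤ (ℤP.≰⇒> zᵢ≱0)) (proj₁ αz∈C′ i))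

    noBoundaryHoles′ : NoBoundaryHoles lam′
    noBoundaryHoles′ w w-hole = onBoundary
      where
      z : Point n
      z = β w
      αz≈w : α z ≈ᵖ w
      αz≈w = α-β w
      z-hole : IsHole lam z
      z-hole = IsHole-pullback z (IsHole-≈ (≈ᵖ-sym αz≈w) w-hole)
      onBoundary : InBoundary lam′ w → ⊥
      onBoundary (inj₂ σλ′w≡0) =
        noHoles z z-hole (inj₂ (trans (sym (σλ′-α z)) (trans (height-≈ (Lcm lam′) (skewCoeff lam′) αz≈w) σλ′w≡0)))
      onBoundary (inj₁ (j , σⱼw≡0)) = cases-≟ {P = λ j → σ j w ≡ + 0 → ⊥} i diag offDiag j σⱼw≡0
        where
        diag : σ i w ≡ + 0 → ⊥
        diag σᵢw≡0 = ℤP.<-irrefl refl (ℤP.≤-<-trans (proj₁ (InQbar⇒InCone (proj₁ z-hole)) i)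
                                                    (subst (σ i z <_) (trans (proj₁ αz≈w i) σᵢw≡0) (σᵢ-increases z z-hole)))
        offDiag : ∀ {j} → ¬ j ≡ i → σ j w ≡ + 0 → ⊥
        offDiag {j} j≢i σⱼw≡0 =
          noHoles z z-hole (inj₁ (j , trans (sym (σ-α-offDiag z j j≢i)) (trans (proj₁ αz≈w j) σⱼw≡0)))

lemma3p2 : (n : ℕ) (lam : Fin n → ℕ) → Positive lam → (i : Fin n) →
    NoBoundaryHoles lam →
    Σ (Point n → Point n) (λ α →
      IsLinear α × IsBijective α
      × (∀ z → IsHole (lamPrime lam i) (α z) → IsHole lam z)
      × (∀ z → IsHole lam z → σ i z < σ i (α z))
      × (∀ z (j : Fin n) → ¬ j ≡ i → σ j (α z) ≡ σ j z)
      × (∀ z → σλ (lamPrime lam i) (α z) ≡ σλ lam z))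
    × NoBoundaryHoles (lamPrime lam i)
lemma3p2 n lam lam>0 i noHoles =
  (α , α-linear , α-bijective , IsHole-pullback noHoles , σᵢ-increases noHoles , σ-α-offDiag , σλ′-α) ,
  noBoundaryHoles′ noHoles
  where open Transform lam lam>0 i
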